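{- Let $\varphi$ be a formula, $\sigma=(\sigma_1,\dots,\sigma_v)$ a uniform substitution and $\rho$ a uniform replacement. Then $(\varphi\circ\sigma)*\rho\approx(\varphi*\rho)\circ(\sigma*\rho)$, where $\sigma*\rho:=(\sigma_1*\rho,\dots,\sigma_v*\rho)$.
   Context: Language: variables $p_1,p_2,\dots$, constants $0,1$, connectives $\neg,\vee$ (others as abbreviations), modal operator $\lozenge$. $\mathbf{E}$ is the smallest set of formulas containing all propositional tautologies and closed under modus ponens, uniform substitution and RE (from $\varphi\leftrightarrow\psi$ infer $\lozenge\varphi\leftrightarrow\lozenge\psi$). $\varphi\approx\psi$ means $\vdash_{\mathbf{E}}\varphi\leftrightarrow\psi$. A uniform substitution $\sigma=(\sigma_1,\dots,\sigma_v)$ is a tuple of formulas; $\varphi\circ\sigma$ is obtained from $\varphi$ (a formula in $p_1,\dots,p_v$) by simultaneously replacing each occurrence of $p_i$ by $\sigma_i$. A uniform replacement (UR) is a formula $\rho(e)$ of modal degree at most 1 in the single variable $e$. For any formula $\varphi$, $\varphi*\rho$ is defined recursively: $0*\rho=0$, $1*\rho=1$, $p_i*\rho=p_i$, $(\psi\vee\theta)*\rho=(\psi*\rho)\vee(\theta*\rho)$, $(\neg\psi)*\rho=\neg(\psi*\rho)$, $(\lozenge\psi)*\rho=\rho(\psi*\rho)$ (substitute $\psi*\rho$ for $e$ in $\rho(e)$). -}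

module Defs where

open import Data.Nat using (ℕ; zero; suc; _<_; _≤_; _⊔_; _<?_)
open import Data.Bool using (Bool; true; false; not; _∨_)
open import Data.Vec using (Vec; lookup)
open import Data.Fin using (fromℕ<)
open import Relation.Nullary using (yes; no)
open import Relation.Binary.PropositionalEquality using (_≡_)
open import Data.Product using (_×_)
open import Data.Unit using (⊤)
open import Data.Empty using (⊥)

-- Formulas. Variable p_{i+1} is represented as `var i`.
data Fm : Set where
  var  : ℕ → Fm
  ⊥'   : Fm
  ⊤'   : Fm
  ¬'_  : Fm → Fm
  _∨'_ : Fm → Fm → Fm
  ◇_   : Fm → Fm

infixr 6 _∨'_ _∧'_
infixr 5 _⇒'_
infix 4 _⇔'_
infix 9 ¬'_ ◇_

_∧'_ : Fm → Fm → Fm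
a ∧' b = ¬' (¬' a ∨' ¬' b)

_⇒'_ : Fm → Fm → Fm
a ⇒' b = ¬' a ∨' b

_⇔'_ : Fm → Fm → Fm
a ⇔' b = (a ⇒' b) ∧' (b ⇒' a)

_[_] : Fm → (ℕ → Fm) → Fm
var i      [ s ] = s i
⊥'         [ s ] = ⊥'
⊤'         [ s ] = ⊤'
(¬' a)     [ s ] = ¬' (a [ s ])
(a ∨' b)   [ s ] = (a [ s ]) ∨' (b [ s ])
(◇ a)      [ s ] = ◇ (a [ s ])

-- Propositional tautologies: modal-free formulas true under all Boolean valuations
-- (closure under uniform substitution yields all their modal instances).
ModalFree : Fm → Set
ModalFree (var _)  = ⊤
ModalFree ⊥'       = ⊤
ModalFree ⊤'       = ⊤
ModalFree (¬' a)   = ModalFree a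
ModalFree (a ∨' b) = ModalFree a × ModalFree b
ModalFree (◇ _)    = ⊥

eval : (ℕ → Bool) → Fm → Bool
eval v (var i)  = v i
eval v ⊥'       = false
eval v ⊤'       = true
eval v (¬' a)   = not (eval v a)
eval v (a ∨' b) = eval v a ∨ eval v b
eval v (◇ _)    = false   -- irrelevant: only used on modal-free formulas

Taut : Fm → Set
Taut φ = ModalFree φ × ((v : ℕ → Bool) → eval v φ ≡ true)

data ⊢E : Fm → Set where
  taut : ∀ {φ} → Taut φ → ⊢E φ
  mp   : ∀ {φ ψ} → ⊢E φ → ⊢E (φ ⇒' ψ) → ⊢E ψ
  us   : ∀ {φ} (s : ℕ → Fm) → ⊢E φ → ⊢E (φ [ s ])
  re   : ∀ {φ ψ} → ⊢E (φ ⇔' ψ) → ⊢E (◇ φ ⇔' ◇ ψ)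

_≈_ : Fm → Fm → Set
φ ≈ ψ = ⊢E (φ ⇔' ψ)

VarsBelow : ℕ → Fm → Set
VarsBelow v (var i)  = i < v
VarsBelow v ⊥'       = ⊤
VarsBelow v ⊤'       = ⊤
VarsBelow v (¬' a)   = VarsBelow v a
VarsBelow v (a ∨' b) = VarsBelow v a × VarsBelow v b
VarsBelow v (◇ a)    = VarsBelow v a

-- φ ∘ σ for a tuple σ = (σ_1,…,σ_v); variables outside p_1..p_v are left unchanged
-- (irrelevant when VarsBelow v φ holds).
tupleSubst : ∀ {v} → Vec Fm v → ℕ → Fm
tupleSubst {v} σ i with i <? v
... | yes i<v = lookup σ (fromℕ< i<v)
... | no  _   = var i

_∘ˢ_ : ∀ {v} → Fm → Vec Fm v → Fm
φ ∘ˢ σ = φ [ tupleSubst σ ]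

md : Fm → ℕ
md (var _)  = 0
md ⊥'       = 0
md ⊤'       = 0
md (¬' a)   = md a
md (a ∨' b) = md a ⊔ md b
md (◇ a)    = suc (md a)

-- Uniform replacement: a formula ρ(e) of modal degree ≤ 1 whose only variable is e,
-- where e is represented as `var 0`.
record UR : Set where
  field
    ρ      : Fm
    onlyE  : VarsBelow 1 ρ
    deg≤1  : md ρ ≤ 1

plug : Fm → Fm → Fm
plug r ψ = r [ (λ _ → ψ) ]

_*_ : Fm → UR → Fm
var i    * R = var i
⊥'       * R = ⊥'
⊤'       * R = ⊤'
(¬' a)   * R = ¬' (a * R)
(a ∨' b) * R = (a * R) ∨' (b * R)
(◇ a)    * R = plug (UR.ρ R) (a * R)

_*ˢ_ : ∀ {v} → Vec Fm v → UR → Vec Fm v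
σ *ˢ R = Data.Vec.map (λ s → s * R) σ

-- The identity holds syntactically, not merely modulo E. Replacement commutes
-- with an arbitrary substitution s, i.e. (φ [ s ]) * ρ ≡ (φ * ρ) [ s * ρ ],
-- by induction on φ. In the ◇ case both sides are ρ(e) with e replaced by a
-- single formula: substitutions compose, and the induction hypothesis
-- identifies the two formulas.
module Submission where

open import Defs
open import Data.Nat using (ℕ; _<?_)
open import Data.Vec using (Vec)
open import Data.Vec.Properties using (lookup-map)
open import Data.Fin using (fromℕ<)
open import Data.Bool using (Bool; true; false)
open import Data.Product using (_,_)
open import Data.Unit using (tt)
open import Relation.Nullary using (yes; no)
open import Relation.Binary.PropositionalEquality
  using (_≡_; refl; sym; cong; cong₂; module ≡-Reasoning)

[]-[] : ∀ (φ : Fm) (s t : ℕ → Fm) → (φ [ s ]) [ t ] ≡ φ [ (λ i → s i [ t ]) ]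
[]-[] (var i)  s t = refl
[]-[] ⊥'       s t = refl
[]-[] ⊤'       s t = refl
[]-[] (¬' φ)   s t = cong ¬'_ ([]-[] φ s t)
[]-[] (φ ∨' ψ) s t = cong₂ _∨'_ ([]-[] φ s t) ([]-[] ψ s t)
[]-[] (◇ φ)    s t = cong ◇_ ([]-[] φ s t)

[]-cong : ∀ (φ : Fm) {s t : ℕ → Fm} → (∀ i → s i ≡ t i) → φ [ s ] ≡ φ [ t ]
[]-cong (var i)  e = e i
[]-cong ⊥'       e = refl
[]-cong ⊤'       e = refl
[]-cong (¬' φ)   e = cong ¬'_ ([]-cong φ e)
[]-cong (φ ∨' ψ) e = cong₂ _∨'_ ([]-cong φ e) ([]-cong ψ e)
[]-cong (◇ φ)    e = cong ◇_ ([]-cong φ e)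

plug-[] : ∀ (r ψ : Fm) (t : ℕ → Fm) → (plug r ψ) [ t ] ≡ plug r (ψ [ t ])
plug-[] r ψ = []-[] r (λ _ → ψ)

*-[] : ∀ (φ : Fm) (s : ℕ → Fm) (R : UR) →
       (φ [ s ]) * R ≡ (φ * R) [ (λ i → s i * R) ]
*-[] (var i)  s R = refl
*-[] ⊥'       s R = refl
*-[] ⊤'       s R = refl
*-[] (¬' φ)   s R = cong ¬'_ (*-[] φ s R)
*-[] (φ ∨' ψ) s R = cong₂ _∨'_ (*-[] φ s R) (*-[] ψ s R)
*-[] (◇ φ)    s R = begin
    plug ρ ((φ [ s ]) * R)                 ≡⟨ cong (plug ρ) (*-[] φ s R) ⟩
    plug ρ ((φ * R) [ s* ])                ≡⟨ sym (plug-[] ρ (φ * R) s*) ⟩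
    (plug ρ (φ * R)) [ s* ]                ∎
  where
  open ≡-Reasoning
  open UR R using (ρ)
  s* : ℕ → Fm
  s* i = s i * R

tupleSubst-* : ∀ {v} (σ : Vec Fm v) (R : UR) (i : ℕ) →
               tupleSubst σ i * R ≡ tupleSubst (σ *ˢ R) i
tupleSubst-* {v} σ R i with i <? v
... | yes i<v = sym (lookup-map (fromℕ< i<v) (λ s → s * R) σ)
... | no  _   = refl

∘ˢ-* : ∀ {v} (φ : Fm) (σ : Vec Fm v) (R : UR) →
       (φ ∘ˢ σ) * R ≡ (φ * R) ∘ˢ (σ *ˢ R)
∘ˢ-* φ σ R = begin
    (φ [ tupleSubst σ ]) * R                        ≡⟨ *-[] φ (tupleSubst σ) R ⟩
    (φ * R) [ (λ i → tupleSubst σ i * R) ]          ≡⟨ []-cong (φ * R) (tupleSubst-* σ R) ⟩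
    (φ * R) [ tupleSubst (σ *ˢ R) ]                 ∎
  where open ≡-Reasoning

p⇔p-taut : Taut (var 0 ⇔' var 0)
p⇔p-taut = ((tt , tt) , (tt , tt)) , valid
  where
  valid : (v : ℕ → Bool) → eval v (var 0 ⇔' var 0) ≡ true
  valid v with v 0
  ... | true  = refl
  ... | false = refl

≈-refl : ∀ φ → φ ≈ φ
≈-refl φ = us {var 0 ⇔' var 0} (λ _ → φ) (taut p⇔p-taut)

≡⇒≈ : ∀ {φ ψ} → φ ≡ ψ → φ ≈ ψ
≡⇒≈ {φ} refl = ≈-refl φ

lemma8 : (v : ℕ) (φ : Fm) (σ : Vec Fm v) (R : UR) → VarsBelow v φ →
    ((φ ∘ˢ σ) * R) ≈ ((φ * R) ∘ˢ (σ *ˢ R))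
lemma8 v φ σ R _ = ≡⇒≈ (∘ˢ-* φ σ R)
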